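{- Let $C$ be an $(X,s)$-neighbour transitive code in $H(m,q)$ with minimum distance $\delta$. Then for $\alpha\in C$ and $i\le\min\{s,\lfloor\frac{\delta-1}{2}\rfloor\}$, the stabiliser $X_\alpha$ fixes setwise and acts transitively on $\Gamma_i(\alpha)$. In particular, $X_\alpha$ acts $i$-homogeneously on the set $M$ of entries.
   Context: The Hamming graph $H(m,q)$ has vertices the $m$-tuples over an alphabet $Q$ ($|Q|=q\ge2$) indexed by an entry set $M$ ($|M|=m$), adjacent iff differing in one entry; $\Gamma_i(\alpha)$ is the set of vertices at distance $i$ from $\alpha$. $\mathrm{Aut}(H(m,q))=N\rtimes L$, $N\cong S_q^m$ acting entrywise ($\alpha^g=(\alpha_1^{g_1},\dots,\alpha_m^{g_m})$), $L\cong S_m$ permuting entries ($\alpha^\sigma=(\alpha_{1\sigma^{ -1}},\dots,\alpha_{m\sigma^{ -1}})$); a subgroup $X$ acts on $M$ via $(h_1,\dots,h_m)\sigma\mapsto\sigma$. For a code $C$ (set of vertices, $|C|\ge2$), $\delta=\min\{d(\alpha,\beta):\alpha\ne\beta\in C\}$, $C_i$ is the set of vertices at distance exactly $i$ from $C$, $\mathrm{Aut}(C)$ its setwise stabiliser. For $X\le\mathrm{Aut}(C)$, $C$ is $(X,s)$-neighbour transitive if $X$ is transitive on each of $C,C_1,\dots,C_s$. A group acts $i$-homogeneously on $M$ if it is transitive on the set of $i$-subsets of $M$. -}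

module Defs where

open import Data.Nat using (ℕ; zero; suc; _+_)
open import Data.Fin using (Fin)
open import Data.Fin.Properties using (_≟_)
open import Data.Fin.Permutation using (Permutation′; _⟨$⟩ʳ_; _⟨$⟩ˡ_; _∘ₚ_; flip; id)
open import Data.Fin.Subset using (Subset)
open import Data.Vec using (Vec; []; _∷_; lookup; tabulate)
open import Data.Product using (Σ; _×_; ∃)
open import Relation.Binary.PropositionalEquality using (_≡_; _≢_)
open import Relation.Nullary using (yes; no)
open import Data.Nat using (_≤_)

-- Vertices of H(m,q): m-tuples over Q = Fin q, entries indexed by M = Fin m.
Vertex : ℕ → ℕ → Set
Vertex m q = Vec (Fin q) m

-- Hamming distance = graph distance in H(m,q): number of differing entries.
dist : ∀ {m q} → Vertex m q → Vertex m q → ℕ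
dist [] [] = 0
dist (x ∷ xs) (y ∷ ys) with x ≟ y
... | yes _ = dist xs ys
... | no  _ = suc (dist xs ys)

Γ : ∀ {m q} → ℕ → Vertex m q → Vertex m q → Set
Γ i α β = dist α β ≡ i

-- Elements (h_1,…,h_m)σ of Aut(H(m,q)) = N ⋊ L, N ≅ S_q^m, L ≅ S_m.
record Aut (m q : ℕ) : Set where
  constructor _·_
  field
    h : Fin m → Permutation′ q
    σ : Permutation′ m           -- entry permutation, i ↦ iσ is σ ⟨$⟩ʳ i
open Aut public

-- α^{(h)σ} : first apply h entrywise, then permute entries:
-- (α^{hσ})_j = (α_{jσ⁻¹})^{h_{jσ⁻¹}}
act : ∀ {m q} → Vertex m q → Aut m q → Vertex m q
act α g = tabulate λ j → h g (σ g ⟨$⟩ˡ j) ⟨$⟩ʳ lookup α (σ g ⟨$⟩ˡ j)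

-- group structure (so that act (act α g) g' = act α (g * g'))
e : ∀ {m q} → Aut m q
e = (λ _ → id) · id

_*_ : ∀ {m q} → Aut m q → Aut m q → Aut m q
g * g' = (λ k → h g k ∘ₚ h g' (σ g ⟨$⟩ʳ k)) · (σ g ∘ₚ σ g')

inv : ∀ {m q} → Aut m q → Aut m q
inv g = (λ j → flip (h g (σ g ⟨$⟩ˡ j))) · flip (σ g)

record IsSubgroup {m q} (X : Aut m q → Set) : Set where
  field
    has-e   : X e
    has-*   : ∀ {g g'} → X g → X g' → X (g * g')
    has-inv : ∀ {g} → X g → X (inv g)

-- induced action of X on M: g = (h)σ ↦ σ; image of a subset I ⊆ M under σ
imageSubset : ∀ {m q} → Aut m q → Subset m → Subset m
imageSubset g I = tabulate λ x → lookup I (σ g ⟨$⟩ˡ x)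

Code : ℕ → ℕ → Set₁
Code m q = Vertex m q → Set

DistFrom : ∀ {m q} → Code m q → ℕ → Vertex m q → Set
DistFrom C i β = (∃ λ α → C α × dist α β ≡ i) × (∀ α → C α → i ≤ dist α β)

-- δ is the minimum distance of C (which forces |C| ≥ 2)
IsMinDist : ∀ {m q} → Code m q → ℕ → Set
IsMinDist C δ =
  (Σ _ λ α → Σ _ λ β → C α × C β × α ≢ β × dist α β ≡ δ)
  × (∀ α β → C α → C β → α ≢ β → δ ≤ dist α β)

StabilisesCode : ∀ {m q} → (Aut m q → Set) → Code m q → Set
StabilisesCode X C = ∀ g → X g → ∀ α → (C α → C (act α g)) × (C (act α g) → C α)

TransitiveOn : ∀ {m q} → (Aut m q → Set) → (Vertex m q → Set) → Set
TransitiveOn X S = ∀ β γ → S β → S γ → ∃ λ g → X g × act β g ≡ γ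

NeighbourTransitive : ∀ {m q} → (Aut m q → Set) → Code m q → ℕ → Set
NeighbourTransitive X C s =
  TransitiveOn X C × (∀ k → k ≤ s → TransitiveOn X (DistFrom C k))

Stab : ∀ {m q} → (Aut m q → Set) → Vertex m q → Aut m q → Set
Stab X α g = X g × act α g ≡ α

-- The Hamming distance d(α,β) is the size of the set diff(α,β) ⊆ M of
-- entries where α and β differ; an automorphism (h)σ maps diff(α,β) to its
-- image under σ, hence is an isometry.  Since 2i < δ, balls of radius i about
-- distinct codewords are disjoint, so Γ_i(α) ⊆ C_i, and an element of X
-- mapping one point of Γ_i(α) to another must fix α, the unique codeword
-- near both.  So transitivity of X on C_i yields transitivity of X_α on
-- Γ_i(α).  As q ≥ 2, each i-subset I ⊆ M is diff(α,β) for some β ∈ Γ_i(α),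
-- and an element of X_α mapping such a β for I to one for J maps I to J.
module Submission where

open import Defs
open import Data.Nat using (ℕ; _≤_; _⊓_; _∸_)
open import Data.Nat.DivMod using (_/_)
open import Data.Fin.Subset using (Subset; ∣_∣)
open import Data.Product using (_×_; ∃)
open import Relation.Binary.PropositionalEquality using (_≡_)

open import Data.Nat using (zero; suc; _+_; _<_; z≤n; s≤s; _≤?_)
  renaming (_*_ to _*ℕ_)
open import Data.Nat.Properties
  using (≤-trans; ≤-reflexive; +-mono-≤; +-identityʳ; *-comm; <⇒≤;
         ≰⇒>; <⇒≱; m≤n⊓o⇒m≤n; m≤n⊓o⇒m≤o; +-commutativeSemigroup;
         +-0-commutativeMonoid; *-monoˡ-≤; module ≤-Reasoning)
open import Data.Nat.DivMod using (m/n*n≤m)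
open import Data.Fin using (Fin)
open import Data.Fin.Properties using (_≟_)
open import Data.Fin.Permutation using (Permutation′; _⟨$⟩ʳ_; _⟨$⟩ˡ_; flip; inverseˡ)
open import Data.Bool using (Bool; true; false; if_then_else_)
open import Data.Vec using ([]; _∷_; lookup; tabulate)
open import Data.Vec.Properties using (≡-dec; lookup∘tabulate; tabulate-cong)
open import Data.Product using (_,_; proj₁; proj₂)
open import Data.Empty using (⊥-elim)
open import Relation.Nullary using (yes; no)
open import Relation.Binary.PropositionalEquality
  using (_≢_; refl; sym; trans; cong; cong₂; module ≡-Reasoning)
open import Algebra.Properties.CommutativeSemigroup +-commutativeSemigroup
  using (interchange)
open import Algebra.Properties.CommutativeMonoid.Sum +-0-commutativeMonoid
  using (sum; sum-permute; sum-cong-≗)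

differ : ∀ {q} → Fin q → Fin q → Bool
differ x y with x ≟ y
... | yes _ = false
... | no  _ = true

weight : Bool → ℕ
weight true  = 1
weight false = 0

diffSet : ∀ {m q} → Vertex m q → Vertex m q → Subset m
diffSet α β = tabulate λ k → differ (lookup α k) (lookup β k)

dist≡∣diffSet∣ : ∀ {m q} (α β : Vertex m q) → dist α β ≡ ∣ diffSet α β ∣
dist≡∣diffSet∣ [] [] = refl
dist≡∣diffSet∣ (x ∷ xs) (y ∷ ys) with x ≟ y
... | yes _ = dist≡∣diffSet∣ xs ys
... | no  _ = cong suc (dist≡∣diffSet∣ xs ys)

dist-∷ : ∀ {m q} (x y : Fin q) (xs ys : Vertex m q) →
         dist (x ∷ xs) (y ∷ ys) ≡ weight (differ x y) + dist xs ys
dist-∷ x y xs ys with x ≟ y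
... | yes _ = refl
... | no  _ = refl

differ-triangle : ∀ {q} (x y z : Fin q) →
                  weight (differ x z) ≤ weight (differ x y) + weight (differ y z)
differ-triangle x y z with x ≟ z | x ≟ y | y ≟ z
... | yes _    | _        | _        = z≤n
... | no  _    | no  _    | _        = s≤s z≤n
... | no  _    | yes _    | no  _    = s≤s z≤n
... | no  x≢z  | yes refl | yes refl = ⊥-elim (x≢z refl)

differ-sym : ∀ {q} (x y : Fin q) → differ x y ≡ differ y x
differ-sym x y with x ≟ y | y ≟ x
... | yes _    | yes _ = refl
... | no  _    | no  _ = refl
... | yes refl | no y≢x = ⊥-elim (y≢x refl)
... | no  x≢y  | yes refl = ⊥-elim (x≢y refl)

differ-permute : ∀ {q} (π : Permutation′ q) (x y : Fin q) →
                 differ (π ⟨$⟩ʳ x) (π ⟨$⟩ʳ y) ≡ differ x y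
differ-permute π x y with x ≟ y | (π ⟨$⟩ʳ x) ≟ (π ⟨$⟩ʳ y)
... | yes _    | yes _ = refl
... | no  _    | no  _ = refl
... | yes refl | no πx≢πy = ⊥-elim (πx≢πy refl)
... | no  x≢y  | yes πx≡πy =
  ⊥-elim (x≢y (trans (sym (inverseˡ π)) (trans (cong (π ⟨$⟩ˡ_) πx≡πy) (inverseˡ π))))

dist-sym : ∀ {m q} (α β : Vertex m q) → dist α β ≡ dist β α
dist-sym α β = begin
  dist α β           ≡⟨ dist≡∣diffSet∣ α β ⟩
  ∣ diffSet α β ∣    ≡⟨ cong ∣_∣ (tabulate-cong λ k → differ-sym (lookup α k) (lookup β k)) ⟩
  ∣ diffSet β α ∣    ≡⟨ sym (dist≡∣diffSet∣ β α) ⟩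
  dist β α           ∎
  where open ≡-Reasoning

dist-triangle : ∀ {m q} (α β γ : Vertex m q) → dist α γ ≤ dist α β + dist β γ
dist-triangle [] [] [] = z≤n
dist-triangle (x ∷ xs) (y ∷ ys) (z ∷ zs)
  rewrite dist-∷ x z xs zs | dist-∷ x y xs ys | dist-∷ y z ys zs =
  ≤-trans (+-mono-≤ (differ-triangle x y z) (dist-triangle xs ys zs))
          (≤-reflexive (interchange (weight (differ x y)) (weight (differ y z))
                                    (dist xs ys) (dist ys zs)))

dist≡0⇒≡ : ∀ {m q} (α β : Vertex m q) → dist α β ≡ 0 → α ≡ β
dist≡0⇒≡ [] [] _ = refl
dist≡0⇒≡ (x ∷ xs) (y ∷ ys) d≡0 with x ≟ y | d≡0
... | yes refl | xs≡ys = cong (x ∷_) (dist≡0⇒≡ xs ys xs≡ys)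
... | no  _    | ()

∣I∣≡sum : ∀ {m} (I : Subset m) → ∣ I ∣ ≡ sum (λ k → weight (lookup I k))
∣I∣≡sum [] = refl
∣I∣≡sum (true  ∷ I) = cong suc (∣I∣≡sum I)
∣I∣≡sum (false ∷ I) = ∣I∣≡sum I

∣permuted-subset∣ : ∀ {m} (π : Permutation′ m) (I : Subset m) →
                    ∣ tabulate (λ j → lookup I (π ⟨$⟩ˡ j)) ∣ ≡ ∣ I ∣
∣permuted-subset∣ π I = begin
  ∣ πI ∣
    ≡⟨ ∣I∣≡sum πI ⟩
  sum (λ j → weight (lookup πI j))
    ≡⟨ sum-cong-≗ (λ j → cong weight (lookup∘tabulate (λ j → lookup I (π ⟨$⟩ˡ j)) j)) ⟩
  sum (λ j → weight (lookup I (π ⟨$⟩ˡ j)))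
    ≡⟨ sym (sum-permute (λ k → weight (lookup I k)) (flip π)) ⟩
  sum (λ k → weight (lookup I k))
    ≡⟨ sym (∣I∣≡sum I) ⟩
  ∣ I ∣ ∎
  where
  open ≡-Reasoning
  πI : Subset _
  πI = tabulate (λ j → lookup I (π ⟨$⟩ˡ j))

lookup-act : ∀ {m q} (α : Vertex m q) g j →
             lookup (act α g) j ≡ h g (σ g ⟨$⟩ˡ j) ⟨$⟩ʳ lookup α (σ g ⟨$⟩ˡ j)
lookup-act α g j = lookup∘tabulate _ j

diffSet-act : ∀ {m q} (α β : Vertex m q) g →
              diffSet (act α g) (act β g) ≡ imageSubset g (diffSet α β)
diffSet-act α β g = tabulate-cong λ j → begin
  differ (lookup (act α g) j) (lookup (act β g) j)
    ≡⟨ cong₂ differ (lookup-act α g j) (lookup-act β g j) ⟩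
  differ (h g (k j) ⟨$⟩ʳ lookup α (k j)) (h g (k j) ⟨$⟩ʳ lookup β (k j))
    ≡⟨ differ-permute (h g (k j)) _ _ ⟩
  differ (lookup α (k j)) (lookup β (k j))
    ≡⟨ sym (lookup∘tabulate _ (k j)) ⟩
  lookup (diffSet α β) (k j) ∎
  where
  open ≡-Reasoning
  k : _ → _
  k j = σ g ⟨$⟩ˡ j

isometry : ∀ {m q} (α β : Vertex m q) g → dist (act α g) (act β g) ≡ dist α β
isometry α β g = begin
  dist (act α g) (act β g)              ≡⟨ dist≡∣diffSet∣ (act α g) (act β g) ⟩
  ∣ diffSet (act α g) (act β g) ∣       ≡⟨ cong ∣_∣ (diffSet-act α β g) ⟩
  ∣ imageSubset g (diffSet α β) ∣       ≡⟨ ∣permuted-subset∣ (σ g) (diffSet α β) ⟩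
  ∣ diffSet α β ∣                       ≡⟨ sym (dist≡∣diffSet∣ α β) ⟩
  dist α β                              ∎
  where open ≡-Reasoning

other : ∀ {q} → 2 ≤ q → Fin q → Fin q
other (s≤s (s≤s _)) Fin.zero    = Fin.suc Fin.zero
other (s≤s (s≤s _)) (Fin.suc _) = Fin.zero

differ-other : ∀ {q} (q≥2 : 2 ≤ q) (x : Fin q) → differ x (other q≥2 x) ≡ true
differ-other (s≤s (s≤s _)) Fin.zero    = refl
differ-other (s≤s (s≤s _)) (Fin.suc _) = refl

differ-self : ∀ {q} (x : Fin q) → differ x x ≡ false
differ-self x with x ≟ x
... | yes _   = refl
... | no  x≢x = ⊥-elim (x≢x refl)

changeOn : ∀ {m q} → 2 ≤ q → Vertex m q → Subset m → Vertex m q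
changeOn q≥2 [] [] = []
changeOn q≥2 (x ∷ xs) (b ∷ I) = (if b then other q≥2 x else x) ∷ changeOn q≥2 xs I

diffSet-changeOn : ∀ {m q} (q≥2 : 2 ≤ q) (α : Vertex m q) (I : Subset m) →
                   diffSet α (changeOn q≥2 α I) ≡ I
diffSet-changeOn q≥2 [] [] = refl
diffSet-changeOn q≥2 (x ∷ xs) (true ∷ I) =
  cong₂ _∷_ (differ-other q≥2 x) (diffSet-changeOn q≥2 xs I)
diffSet-changeOn q≥2 (x ∷ xs) (false ∷ I) =
  cong₂ _∷_ (differ-self x) (diffSet-changeOn q≥2 xs I)

dist-changeOn : ∀ {m q} (q≥2 : 2 ≤ q) (α : Vertex m q) (I : Subset m) →
                dist α (changeOn q≥2 α I) ≡ ∣ I ∣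
dist-changeOn q≥2 α I =
  trans (dist≡∣diffSet∣ α _) (cong ∣_∣ (diffSet-changeOn q≥2 α I))

minDist-positive : ∀ {m q} {C : Code m q} {δ} → IsMinDist C δ → 1 ≤ δ
minDist-positive ((α , β , _ , _ , α≢β , dαβ≡δ) , _) with dist α β in dαβ
... | zero  = ⊥-elim (α≢β (dist≡0⇒≡ α β dαβ))
... | suc _ rewrite sym dαβ≡δ = s≤s z≤n

double-radius< : ∀ {i δ} → 1 ≤ δ → i ≤ (δ ∸ 1) / 2 → i + i < δ
double-radius< {i} {suc d} _ i≤d/2 = s≤s (begin
  i + i            ≡⟨ cong (i +_) (sym (+-identityʳ i)) ⟩
  2 *ℕ i           ≡⟨ *-comm 2 i ⟩
  i *ℕ 2           ≤⟨ *-monoˡ-≤ 2 i≤d/2 ⟩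
  (d / 2) *ℕ 2     ≤⟨ m/n*n≤m d 2 ⟩
  d                ∎)
  where open ≤-Reasoning

module _ {m q} {C : Code m q} {δ : ℕ}
         (minDist : ∀ α β → C α → C β → α ≢ β → δ ≤ dist α β) where

  nearest-codeword-unique : ∀ {i α α′ γ} → i + i < δ → C α → C α′ →
                            dist α γ ≤ i → dist α′ γ ≤ i → α′ ≡ α
  nearest-codeword-unique {i} {α} {α′} {γ} 2i<δ Cα Cα′ dαγ≤i dα′γ≤i
    with ≡-dec _≟_ α′ α
  ... | yes α′≡α = α′≡α
  ... | no  α′≢α = ⊥-elim (<⇒≱ 2i<δ (begin
    δ                       ≤⟨ minDist α α′ Cα Cα′ (λ α≡α′ → α′≢α (sym α≡α′)) ⟩
    dist α α′               ≤⟨ dist-triangle α γ α′ ⟩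
    dist α γ + dist γ α′    ≡⟨ cong (dist α γ +_) (dist-sym γ α′) ⟩
    dist α γ + dist α′ γ    ≤⟨ +-mono-≤ dαγ≤i dα′γ≤i ⟩
    i + i                   ∎))
    where open ≤-Reasoning

  sphere⊆distanceClass : ∀ {i α β} → i + i < δ → C α → Γ i α β → DistFrom C i β
  sphere⊆distanceClass {i} {α} {β} 2i<δ Cα dαβ≡i =
    (α , Cα , dαβ≡i) , at-least-i
    where
    at-least-i : ∀ α′ → C α′ → i ≤ dist α′ β
    at-least-i α′ Cα′ with i ≤? dist α′ β
    ... | yes i≤dα′β = i≤dα′β
    ... | no  i≰dα′β
      with nearest-codeword-unique 2i<δ Cα Cα′ (≤-reflexive dαβ≡i) (<⇒≤ (≰⇒> i≰dα′β))
    ... | refl = ≤-reflexive (sym dαβ≡i)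

  -- If X ≤ Aut(C) is transitive on C_i with 2i < δ, then X_α is transitive
  -- on Γ_i(α): an element of X mapping β ∈ Γ_i(α) to γ ∈ Γ_i(α) must fix α,
  -- the unique codeword within distance i of γ.
  stabiliser-transitive-on-sphere :
    ∀ {X i} → StabilisesCode X C → TransitiveOn X (DistFrom C i) → i + i < δ →
    ∀ {α} → C α → ∀ β γ → Γ i α β → Γ i α γ → ∃ λ g → Stab X α g × act β g ≡ γ
  stabiliser-transitive-on-sphere {i = i} stabilises transitive 2i<δ {α} Cα β γ dαβ≡i dαγ≡i
    with transitive β γ (sphere⊆distanceClass 2i<δ Cα dαβ≡i)
                        (sphere⊆distanceClass 2i<δ Cα dαγ≡i)
  ... | g , Xg , gβ≡γ = g , (Xg , gα≡α) , gβ≡γ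
    where
    dgαγ≡i : dist (act α g) γ ≡ i
    dgαγ≡i = begin
      dist (act α g) γ           ≡⟨ cong (dist (act α g)) (sym gβ≡γ) ⟩
      dist (act α g) (act β g)   ≡⟨ isometry α β g ⟩
      dist α β                   ≡⟨ dαβ≡i ⟩
      i                          ∎
      where open ≡-Reasoning
    gα≡α : act α g ≡ α
    gα≡α = nearest-codeword-unique 2i<δ Cα (proj₁ (stabilises g Xg α) Cα)
             (≤-reflexive dαγ≡i) (≤-reflexive dgαγ≡i)

fixer-preserves-sphere : ∀ {m q i} (α : Vertex m q) g → act α g ≡ α →
                         ∀ β → Γ i α β → Γ i α (act β g)
fixer-preserves-sphere {i = i} α g gα≡α β dαβ≡i = begin
  dist α (act β g)           ≡⟨ cong (λ v → dist v (act β g)) (sym gα≡α) ⟩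
  dist (act α g) (act β g)   ≡⟨ isometry α β g ⟩
  dist α β                   ≡⟨ dαβ≡i ⟩
  i                          ∎
  where open ≡-Reasoning

-- If a set G of automorphisms fixing α is transitive on Γ_i(α), then G acts
-- i-homogeneously on M: the i-subsets I, J are the differing sets of α with
-- changeOn α I and changeOn α J, and an element of G relating the latter
-- two vertices maps I to J.
sphere-transitive⇒homogeneous :
  ∀ {m q i} → 2 ≤ q → (G : Aut m q → Set) (α : Vertex m q) →
  (∀ g → G g → act α g ≡ α) →
  (∀ β γ → Γ i α β → Γ i α γ → ∃ λ g → G g × act β g ≡ γ) →
  ∀ (I J : Subset m) → ∣ I ∣ ≡ i → ∣ J ∣ ≡ i → ∃ λ g → G g × imageSubset g I ≡ J
sphere-transitive⇒homogeneous {m} {q} q≥2 G α fixes transitive I J ∣I∣≡i ∣J∣≡i =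
  maps-I-to-J (transitive βI βJ (trans (dist-changeOn q≥2 α I) ∣I∣≡i)
                                (trans (dist-changeOn q≥2 α J) ∣J∣≡i))
  where
  open ≡-Reasoning
  βI βJ : Vertex m q
  βI = changeOn q≥2 α I
  βJ = changeOn q≥2 α J
  maps-I-to-J : (∃ λ g → G g × act βI g ≡ βJ) → ∃ λ g → G g × imageSubset g I ≡ J
  maps-I-to-J (g , Gg , gβI≡βJ) = g , Gg , (begin
    imageSubset g I                ≡⟨ cong (imageSubset g) (sym (diffSet-changeOn q≥2 α I)) ⟩
    imageSubset g (diffSet α βI)   ≡⟨ sym (diffSet-act α βI g) ⟩
    diffSet (act α g) (act βI g)   ≡⟨ cong₂ diffSet (fixes g Gg) gβI≡βJ ⟩
    diffSet α βJ                   ≡⟨ diffSet-changeOn q≥2 α J ⟩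
    J                              ∎)

proposition2p5 : ∀ {m q : ℕ} → 2 ≤ q →
  (X : Aut m q → Set) → IsSubgroup X →
  (C : Code m q) → StabilisesCode X C →
  (s δ : ℕ) → NeighbourTransitive X C s → IsMinDist C δ →
  ∀ α → C α → ∀ i → i ≤ s ⊓ ((δ ∸ 1) / 2) →
    (∀ g → Stab X α g → ∀ β → Γ i α β → Γ i α (act β g))
    × (∀ β γ → Γ i α β → Γ i α γ → ∃ λ g → Stab X α g × act β g ≡ γ)
    × (∀ (I J : Subset m) → ∣ I ∣ ≡ i → ∣ J ∣ ≡ i →
         ∃ λ g → Stab X α g × imageSubset g I ≡ J)
proposition2p5 q≥2 X _ C stabilises s δ (_ , transitive-on-Cₖ) isMinDist α Cα i i≤s⊓r =
  preserves , transitive , sphere-transitive⇒homogeneous q≥2 (Stab X α) α (λ _ → proj₂) transitive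
  where
  2i<δ : i + i < δ
  2i<δ = double-radius< (minDist-positive isMinDist) (m≤n⊓o⇒m≤o s ((δ ∸ 1) / 2) i≤s⊓r)

  preserves : ∀ g → Stab X α g → ∀ β → Γ i α β → Γ i α (act β g)
  preserves g (_ , gα≡α) = fixer-preserves-sphere α g gα≡α

  transitive : ∀ β γ → Γ i α β → Γ i α γ → ∃ λ g → Stab X α g × act β g ≡ γ
  transitive = stabiliser-transitive-on-sphere (proj₂ isMinDist) stabilises
                 (transitive-on-Cₖ i (m≤n⊓o⇒m≤n s ((δ ∸ 1) / 2) i≤s⊓r)) 2i<δ Cα
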